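{- Let $G$ be a simple, finite, connected graph, let $\{F_1,\ldots,F_k\}$ be a c-partition of $E(G)$, let $G_i=G/F_i$, and let $\lambda':E(G)\to[0,\infty)$ be an edge-weight. Define $\lambda_i:V(G_i)\to[0,\infty)$ by $\lambda_i(X)=\sum_{f\in E(X)}\lambda'(f)$ and $\lambda_i':E(G_i)\to[0,\infty)$ by $\lambda_i'(E)=\sum_{f\in\widehat{E}}\lambda'(f)$. Suppose $e=uv\in F_i$, $U=\ell_i(u)$, $V=\ell_i(v)$ and $E=UV\in E(G_i)$. Then $$m_u(e|(G,\lambda'))=n_U(E|(G_i,\lambda_i))+m_U(E|(G_i,\lambda_i')),\qquad m_v(e|(G,\lambda'))=n_V(E|(G_i,\lambda_i))+m_V(E|(G_i,\lambda_i')).$$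
   Context: $d_G$ is the shortest-path distance; for a vertex $u$ and an edge $f=xy$, $d_G(u,f)=\min\{d_G(u,x),d_G(u,y)\}$. For an edge $e=uv$ of a graph $H$: $N_u(e|H)=\{x\in V(H): d_H(u,x)<d_H(v,x)\}$, $M_u(e|H)=\{f\in E(H): d_H(u,f)<d_H(v,f)\}$. For a vertex-weight $w:V(H)\to[0,\infty)$ and edge-weight $\lambda':E(H)\to[0,\infty)$: $n_u(e|(H,w))=\sum_{x\in N_u(e|H)}w(x)$ and $m_u(e|(H,\lambda'))=\sum_{f\in M_u(e|H)}\lambda'(f)$ (zero if the set is empty); similarly for $v$. The Djoković–Winkler relation $\Theta$: $u_1v_1\,\Theta\,u_2v_2$ iff $d(u_1,u_2)+d(v_1,v_2)\neq d(u_1,v_2)+d(u_2,v_1)$; $\Theta^*$ is its transitive closure. A c-partition of $E(G)$ is a partition each of whose parts is a union of $\Theta^*$-classes. $G/F$ is the quotient graph whose vertices are the connected components of $G\setminus F$ (edges of $F$ deleted), two components adjacent if some vertex of one is adjacent in $G$ to a vertex of the other; for an edge $E=XY$ of $G/F$, $\widehat{E}$ is the set of edges of $G$ with one end in $X$ and the other in $Y$. $\ell_i(u)$ is the component of $G\setminus F_i$ containing $u$.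
   Formalization: The edge-weight λ' takes nonnegative rational values rather than values in $[0,\infty)$. -}

module Defs where

open import Data.Bool using (Bool; true; false; _∧_; _∨_; if_then_else_)
open import Data.Nat using (ℕ; zero; suc; _≤_; _<ᵇ_; _⊓_)
open import Data.Fin using (Fin; zero; suc; toℕ; _≟_)
open import Data.Product using (Σ; ∃; _×_; _,_)
open import Data.Rational using (ℚ; 0ℚ; _+_)
open import Relation.Nullary using (¬_)
open import Relation.Nullary.Decidable using (⌊_⌋)
open import Relation.Binary.PropositionalEquality using (_≡_; _≢_)
open import Relation.Binary.Construct.Closure.Transitive using (TransClosure)

Adjacency : ℕ → Set
Adjacency n = Fin n → Fin n → Bool

IsSimple : ∀ {n} → Adjacency n → Set
IsSimple {n} adj = (∀ (x y : Fin n) → adj x y ≡ adj y x) × (∀ (x : Fin n) → adj x x ≡ false)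

data Walk {n : ℕ} (R : Fin n → Fin n → Set) : Fin n → Fin n → ℕ → Set where
  []  : ∀ {x} → Walk R x x 0
  _∷_ : ∀ {x y z k} → R x y → Walk R y z k → Walk R x z (suc k)

Edge? : ∀ {n} → Adjacency n → Fin n → Fin n → Set
Edge? adj x y = adj x y ≡ true

Connected : ∀ {n} → Adjacency n → Set
Connected {n} adj = ∀ (x y : Fin n) → ∃ λ k → Walk (Edge? adj) x y k

IsDist : ∀ {n} → Adjacency n → (Fin n → Fin n → ℕ) → Set
IsDist {n} adj d = ∀ (x y : Fin n) →
  Walk (Edge? adj) x y (d x y) × (∀ k → Walk (Edge? adj) x y k → d x y ≤ k)

distE : ∀ {n} → (Fin n → Fin n → ℕ) → Fin n → Fin n → Fin n → ℕ
distE d u x y = d u x ⊓ d u y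

sumFin : ∀ {n} → (Fin n → ℚ) → ℚ
sumFin {zero}  f = 0ℚ
sumFin {suc n} f = f zero + sumFin (λ i → f (suc i))

sumWhere : ∀ {n} → (Fin n → Bool) → (Fin n → ℚ) → ℚ
sumWhere P w = sumFin (λ x → if P x then w x else 0ℚ)

sumEdges : ∀ {n} → Adjacency n → (Fin n → Fin n → Bool) → (Fin n → Fin n → ℚ) → ℚ
sumEdges adj P w =
  sumFin (λ x → sumFin (λ y → if adj x y ∧ (toℕ x <ᵇ toℕ y) ∧ P x y then w x y else 0ℚ))

nPart : ∀ {n} → (Fin n → Fin n → ℕ) → (Fin n → ℚ) → Fin n → Fin n → ℚ
nPart d w u v = sumWhere (λ x → d u x <ᵇ d v x) w

mPart : ∀ {n} → Adjacency n → (Fin n → Fin n → ℕ) → (Fin n → Fin n → ℚ) → Fin n → Fin n → ℚ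
mPart adj d w u v = sumEdges adj (λ x y → distE d u x y <ᵇ distE d v x y) w

record Edge {n : ℕ} (adj : Adjacency n) : Set where
  constructor edge
  field
    src tgt : Fin n
    isEdge  : adj src tgt ≡ true
open Edge public

Θ : ∀ {n} {adj : Adjacency n} → (Fin n → Fin n → ℕ) → Edge adj → Edge adj → Set
Θ d e f = d (src e) (src f) Data.Nat.+ d (tgt e) (tgt f)
        ≢ d (src e) (tgt f) Data.Nat.+ d (src f) (tgt e)

Θ* : ∀ {n} {adj : Adjacency n} → (Fin n → Fin n → ℕ) → Edge adj → Edge adj → Set
Θ* d = TransClosure (Θ d)

-- c : labels each edge xy by the index of its part; parts F_1..F_k.
-- A c-partition: parts nonempty, and each part a union of Θ*-classes.
IsCPartition : ∀ {n k} (adj : Adjacency n) → (Fin n → Fin n → ℕ) → (Fin n → Fin n → Fin k) → Set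
IsCPartition {n} {k} adj d c =
  (∀ (i : Fin k) → Σ (Edge adj) λ e → c (src e) (tgt e) ≡ i)
  × (∀ (e f : Edge adj) → Θ* d e f → c (src e) (tgt e) ≡ c (src f) (tgt f))

MinusAdj : ∀ {n k} → Adjacency n → (Fin n → Fin n → Fin k) → Fin k → Fin n → Fin n → Set
MinusAdj adj c i x y = (adj x y ≡ true) × (c x y ≢ i)

-- ℓ : V(G) → Fin m is (a labelling of) the map u ↦ ℓ_i(u), i.e. its fibres
-- are exactly the connected components of G \ F_i, and every label is used.
IsComponentMap : ∀ {n k m} → Adjacency n → (Fin n → Fin n → Fin k) → Fin k → (Fin n → Fin m) → Set
IsComponentMap {n} {k} {m} adj c i ℓ =
  (∀ (x y : Fin n) → ℓ x ≡ ℓ y → ∃ λ j → Walk (MinusAdj adj c i) x y j)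
  × (∀ (x y : Fin n) → (∃ λ j → Walk (MinusAdj adj c i) x y j) → ℓ x ≡ ℓ y)
  × (∀ (X : Fin m) → ∃ λ x → ℓ x ≡ X)

anyFin : ∀ {n} → (Fin n → Bool) → Bool
anyFin {zero}  f = false
anyFin {suc n} f = f zero ∨ anyFin (λ i → f (suc i))

_==_ : ∀ {m} → Fin m → Fin m → Bool
X == Y = ⌊ X ≟ Y ⌋

not : Bool → Bool
not true = false
not false = true

quotAdj : ∀ {n m} → Adjacency n → (Fin n → Fin m) → Adjacency m
quotAdj adj ℓ X Y = not (X == Y) ∧
  anyFin (λ x → anyFin (λ y → adj x y ∧ (ℓ x == X) ∧ (ℓ y == Y)))

vertWeight : ∀ {n m} → Adjacency n → (Fin n → Fin m) → (Fin n → Fin n → ℚ) → Fin m → ℚ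
vertWeight adj ℓ w X = sumEdges adj (λ x y → (ℓ x == X) ∧ (ℓ y == X)) w

edgeWeight : ∀ {n m} → Adjacency n → (Fin n → Fin m) → (Fin n → Fin n → ℚ) → Fin m → Fin m → ℚ
edgeWeight adj ℓ w X Y =
  sumEdges adj (λ x y → ((ℓ x == X) ∧ (ℓ y == Y)) ∨ ((ℓ x == Y) ∧ (ℓ y == X))) w

{-# OPTIONS --safe #-}
module Submission where

-- Write F for the class c ≡ i, #F for the number of F-edges on a walk, and
-- θ(pq, rs) = d(p,s) + d(q,r) − d(p,r) − d(q,s), so that pq Θ rs iff θ(pq, rs) ≠ 0.
-- θ is additive along walks in each of its two edge arguments, and θ(e, f) = 0 when e and f
-- lie in different classes. Hence, for walks P : x → y and w : s → t, double counting gives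
--   Σ_{e ∈ P} χ_F(e) θ(e, st) = Σ_{f ∈ w} χ_F(f) θ(xy, f).
-- On a geodesic P every edge has θ(e, xy) = 2, while θ(xy, f) ≤ 2 for every edge f; so a
-- geodesic carries the fewest F-edges among all walks with its ends. Projecting walks to G/F
-- and lifting them back then gives #F(P) = d_{G/F}(ℓx, ℓy) for every geodesic P from x to y,
-- and therefore d(a,z) − d(b,z) = d_{G/F}(ℓa,ℓz) − d_{G/F}(ℓb,ℓz) for every F-edge ab
-- (when d(a,z) = d(b,z), the double counting is applied once more, to w = ab followed by a
-- walk from b to z).
-- For e = uv this turns each comparison in M_u(e) into one in G/F: an edge inside a component
-- X is closer to u iff X is closer to U, and an F-edge between components X ≠ Y is closer to u
-- iff the quotient edge XY is closer to U. Grouping the edges of G by component and by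
-- quotient edge yields n_U(E) + m_U(E).

open import Defs
import Algebra.Properties.CommutativeSemigroup as CommutativeSemigroupProperties
open import Data.Bool using (Bool; true; false; _∧_; _∨_; if_then_else_)
open import Data.Bool.Properties using (⇔→≡; ∨-zeroʳ; T-≡; ∧-idem; ∧-comm; ¬-not)
open import Data.Empty using (⊥)
open import Data.Fin using (Fin; zero; suc; toℕ; _≟_; punchIn)
open import Data.Fin.Properties using (punchInᵢ≢i; toℕ-injective)
open import Data.Integer using (ℤ; +_; 0ℤ; 1ℤ)
import Data.Integer.Properties as ℤP
open import Data.Integer.Tactic.RingSolver using (solve-∀)
open import Data.Nat as ℕ using (ℕ; zero; suc; _<_; _<ᵇ_; _⊓_; z≤n; s≤s)
import Data.Nat.Properties as ℕP
open import Data.Product using (Σ; ∃; ∃₂; _×_; _,_; proj₁; proj₂)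
open import Data.Sum using (_⊎_; inj₁; inj₂)
open import Function using (_∘_; _⇔_; mk⇔; Equivalence)
open import Relation.Binary.Construct.Closure.Transitive using ([_])
open import Relation.Binary.Definitions using (tri<; tri≈; tri>)
open import Relation.Binary.PropositionalEquality
open import Relation.Nullary using (¬_; yes; no; contradiction)

<ᵇ≡true⇔< : ∀ {m n} → (m <ᵇ n) ≡ true ⇔ m < n
<ᵇ≡true⇔< {m} {n} = mk⇔ (ℕP.<ᵇ⇒< m n ∘ Equivalence.from T-≡)
                         (Equivalence.to T-≡ ∘ ℕP.<⇒<ᵇ)

==⇒≡ : ∀ {m} {X Y : Fin m} → (X == Y) ≡ true → X ≡ Y
==⇒≡ {X = X} {Y} h with X ≟ Y
... | yes X≡Y = X≡Y

≡⇒== : ∀ {m} {X Y : Fin m} → X ≡ Y → (X == Y) ≡ true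
≡⇒== {X = X} {Y} X≡Y with X ≟ Y
... | yes _   = refl
... | no X≢Y = contradiction X≡Y X≢Y

≢⇒==-false : ∀ {m} {X Y : Fin m} → X ≢ Y → (X == Y) ≡ false
≢⇒==-false {X = X} {Y} X≢Y with X ≟ Y
... | yes X≡Y = contradiction X≡Y X≢Y
... | no _    = refl

not-==⇒≢ : ∀ {m} {X Y : Fin m} → not (X == Y) ≡ true → X ≢ Y
not-==⇒≢ {X = X} h refl = contradiction (trans (sym (cong not (≡⇒== {X = X} refl))) h) λ ()

∧-true : ∀ {a b} → a ∧ b ≡ true → a ≡ true × b ≡ true
∧-true {true} b≡true = refl , b≡true

∨-true : ∀ {a b} → a ∨ b ≡ true → a ≡ true ⊎ b ≡ true
∨-true {true}  _ = inj₁ refl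
∨-true {false} h = inj₂ h

anyFin-intro : ∀ {n} (f : Fin n → Bool) j → f j ≡ true → anyFin f ≡ true
anyFin-intro f zero    fj rewrite fj = refl
anyFin-intro f (suc j) fj rewrite anyFin-intro (f ∘ suc) j fj = ∨-zeroʳ (f zero)

anyFin-elim : ∀ {n} (f : Fin n → Bool) → anyFin f ≡ true → ∃ λ j → f j ≡ true
anyFin-elim {suc n} f h with f zero in f0
... | true  = zero , f0
... | false = let j , fj = anyFin-elim (f ∘ suc) h in suc j , fj

module _ {n m : ℕ} (adj : Adjacency n) (ℓ : Fin n → Fin m) where

  quotAdj-intro : ∀ {X Y p q} → X ≢ Y → Edge? adj p q → ℓ p ≡ X → ℓ q ≡ Y →
                  Edge? (quotAdj adj ℓ) X Y
  quotAdj-intro {p = p} {q} X≢Y pq refl refl rewrite ≢⇒==-false X≢Y =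
    anyFin-intro _ p (anyFin-intro _ q
      (cong₂ _∧_ pq (cong₂ _∧_ (≡⇒== {X = ℓ p} refl) (≡⇒== {X = ℓ q} refl))))

  quotAdj-elim : ∀ {X Y} → Edge? (quotAdj adj ℓ) X Y →
                 X ≢ Y × ∃₂ λ p q → Edge? adj p q × ℓ p ≡ X × ℓ q ≡ Y
  quotAdj-elim {X} {Y} h
    with distinct , linked ← ∧-true {not (X == Y)} h
    with p , linked-p ← anyFin-elim _ linked
    with q , pq∧ends ← anyFin-elim _ linked-p
    with pq , ends ← ∧-true {adj p q} pq∧ends
    with pX , qY ← ∧-true {ℓ p == X} ends
    = not-==⇒≢ distinct , p , q , pq , ==⇒≡ pX , ==⇒≡ qY

  quotAdj-simple : IsSimple adj → IsSimple (quotAdj adj ℓ)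
  quotAdj-simple (adj-sym , _) = (λ X Y → ⇔→≡ (mk⇔ flip flip)) , irrefl
    where
    flip : ∀ {X Y} → Edge? (quotAdj adj ℓ) X Y → Edge? (quotAdj adj ℓ) Y X
    flip h with X≢Y , p , q , pq , pX , qY ← quotAdj-elim h =
      quotAdj-intro (X≢Y ∘ sym) (trans (adj-sym q p) pq) qY pX
    irrefl : ∀ X → quotAdj adj ℓ X X ≡ false
    irrefl X rewrite ≡⇒== {X = X} refl = refl

module _ {n : ℕ} {R : Fin n → Fin n → Set} where

  open import Data.Integer using (_+_; _*_; _≤_)

  _++ʷ_ : ∀ {x y z k l} → Walk R x y k → Walk R y z l → Walk R x z (k ℕ.+ l)
  []      ++ʷ w = w
  (r ∷ v) ++ʷ w = r ∷ (v ++ʷ w)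

  reverseʷ : (∀ {x y} → R x y → R y x) → ∀ {x y k} → Walk R x y k → Walk R y x k
  reverseʷ R-sym []                  = []
  reverseʷ R-sym {k = suc k} (r ∷ w) =
    subst (Walk R _ _) (ℕP.+-comm k 1) (reverseʷ R-sym w ++ʷ (R-sym r ∷ []))

  mapʷ : ∀ {S : Fin n → Fin n → Set} → (∀ {x y} → R x y → S x y) →
         ∀ {x y k} → Walk R x y k → Walk S x y k
  mapʷ f []      = []
  mapʷ f (r ∷ w) = f r ∷ mapʷ f w

  sumʷ : ∀ {s t k} → Walk R s t k → (Fin n → Fin n → ℤ) → ℤ
  sumʷ []                h = 0ℤ
  sumʷ (_∷_ {p} {q} _ w) h = h p q + sumʷ w h

  sumʷ-cong : ∀ {s t k} (w : Walk R s t k) {h h′} →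
              (∀ {p q} → R p q → h p q ≡ h′ p q) → sumʷ w h ≡ sumʷ w h′
  sumʷ-cong []      eq = refl
  sumʷ-cong (r ∷ w) eq = cong₂ _+_ (eq r) (sumʷ-cong w eq)

  sumʷ-zero : ∀ {s t k} (w : Walk R s t k) → sumʷ w (λ _ _ → 0ℤ) ≡ 0ℤ
  sumʷ-zero []      = refl
  sumʷ-zero (_ ∷ w) = trans (ℤP.+-identityˡ _) (sumʷ-zero w)

  sumʷ-+ : ∀ {s t k} (w : Walk R s t k) (h h′ : Fin n → Fin n → ℤ) →
           sumʷ w (λ p q → h p q + h′ p q) ≡ sumʷ w h + sumʷ w h′
  sumʷ-+ []                h h′ = refl
  sumʷ-+ (_∷_ {p} {q} _ w) h h′ = trans (cong (_+_ (h p q + h′ p q)) (sumʷ-+ w h h′))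
    (CommutativeSemigroupProperties.interchange ℤP.+-commutativeSemigroup
      (h p q) (h′ p q) (sumʷ w h) (sumʷ w h′))

  sumʷ-*ˡ : ∀ {s t k} (w : Walk R s t k) a (h : Fin n → Fin n → ℤ) →
            sumʷ w (λ p q → a * h p q) ≡ a * sumʷ w h
  sumʷ-*ˡ []                a h = sym (ℤP.*-zeroʳ a)
  sumʷ-*ˡ (_∷_ {p} {q} _ w) a h =
    trans (cong (_+_ (a * h p q)) (sumʷ-*ˡ w a h)) (sym (ℤP.*-distribˡ-+ a (h p q) (sumʷ w h)))

  sumʷ-*ʳ : ∀ {s t k} (w : Walk R s t k) a (h : Fin n → Fin n → ℤ) →
            sumʷ w (λ p q → h p q * a) ≡ sumʷ w h * a
  sumʷ-*ʳ w a h = trans (sumʷ-cong w λ {p} {q} _ → ℤP.*-comm (h p q) a)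
                        (trans (sumʷ-*ˡ w a h) (ℤP.*-comm a (sumʷ w h)))

  sumʷ-comm : ∀ {s t k s′ t′ l} (v : Walk R s t k) (w : Walk R s′ t′ l)
              (H : Fin n → Fin n → Fin n → Fin n → ℤ) →
              sumʷ v (λ p q → sumʷ w (H p q)) ≡ sumʷ w (λ r s → sumʷ v (λ p q → H p q r s))
  sumʷ-comm []                w H = sym (sumʷ-zero w)
  sumʷ-comm (_∷_ {p} {q} _ v) w H = trans (cong (_+_ (sumʷ w (H p q))) (sumʷ-comm v w H))
    (sym (sumʷ-+ w (H p q) λ r s → sumʷ v (λ p q → H p q r s)))

  sumʷ-mono-≤ : ∀ {s t k} (w : Walk R s t k) {h h′} →
                (∀ {p q} → R p q → h p q ≤ h′ p q) → sumʷ w h ≤ sumʷ w h′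
  sumʷ-mono-≤ []      le = ℤP.≤-refl
  sumʷ-mono-≤ (r ∷ w) le = ℤP.+-mono-≤ (le r) (sumʷ-mono-≤ w le)

module ShortestPaths {n : ℕ} (adj : Adjacency n) (simple : IsSimple adj)
                     {d : Fin n → Fin n → ℕ} (isDist : IsDist adj d) where

  open import Data.Nat using (_+_; _≤_)

  Path : Fin n → Fin n → ℕ → Set
  Path = Walk (Edge? adj)

  adj-sym : ∀ {x y} → Edge? adj x y → Edge? adj y x
  adj-sym {x} {y} = trans (proj₁ simple y x)

  geodesic : ∀ x y → Path x y (d x y)
  geodesic x y = proj₁ (isDist x y)

  d-minimal : ∀ {x y k} → Path x y k → d x y ≤ k
  d-minimal {x} {y} {k} = proj₂ (isDist x y) k

  d-refl : ∀ x → d x x ≡ 0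
  d-refl x = ℕP.n≤0⇒n≡0 (d-minimal [])

  d-sym : ∀ x y → d x y ≡ d y x
  d-sym x y = ℕP.≤-antisym (d-minimal (reverseʷ adj-sym (geodesic y x)))
                           (d-minimal (reverseʷ adj-sym (geodesic x y)))

  d-triangle : ∀ x y z → d x z ≤ d x y + d y z
  d-triangle x y z = d-minimal (geodesic x y ++ʷ geodesic y z)

  d-adjacent : ∀ {x y} → Edge? adj x y → d x y ≡ 1
  d-adjacent {x} {y} xy with d x y | geodesic x y | d-minimal (xy ∷ [])
  ... | 0           | [] | _      = contradiction (trans (sym (proj₂ simple x)) xy) λ ()
  ... | 1           | _  | _      = refl
  ... | suc (suc _) | _  | s≤s ()

  d-lipschitz : ∀ x {p q} → Edge? adj p q → d x q ≤ suc (d x p)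
  d-lipschitz x {p} {q} pq = begin
    d x q         ≤⟨ d-triangle x p q ⟩
    d x p + d p q ≡⟨ cong (_+_ (d x p)) (d-adjacent pq) ⟩
    d x p + 1     ≡⟨ ℕP.+-comm (d x p) 1 ⟩
    suc (d x p)   ∎
    where open ℕP.≤-Reasoning

  d-step : ∀ {a b} z → Edge? adj a b → d a z < d b z → d b z ≡ suc (d a z)
  d-step {a} {b} z ab a<b = ℕP.≤-antisym (begin
    d b z         ≤⟨ d-triangle b a z ⟩
    d b a + d a z ≡⟨ cong (_+ d a z) (d-adjacent (adj-sym ab)) ⟩
    suc (d a z)   ∎) a<b
    where open ℕP.≤-Reasoning

  geodesic-tail : ∀ {x y z k} → Edge? adj x y → (w : Path y z k) → suc k ≡ d x z → k ≡ d y z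
  geodesic-tail {x} {y} {z} {k} xy w sk≡ = ℕP.≤-antisym (ℕP.≤-pred (begin
    suc k         ≡⟨ sk≡ ⟩
    d x z         ≤⟨ d-triangle x y z ⟩
    d x y + d y z ≡⟨ cong (_+ d y z) (d-adjacent xy) ⟩
    suc (d y z)   ∎)) (d-minimal w)
    where open ℕP.≤-Reasoning

  between-step : ∀ {x p q y} → d x p + d p y ≡ d x y → Edge? adj p q → d p y ≡ suc (d q y) →
                 d x q ≡ suc (d x p)
  between-step {x} {p} {q} {y} between pq py = ℕP.≤-antisym (d-lipschitz x pq)
    (ℕP.+-cancelʳ-≤ (d q y) (suc (d x p)) (d x q) (begin
      suc (d x p) + d q y ≡⟨ ℕP.+-suc (d x p) (d q y) ⟨
      d x p + suc (d q y) ≡⟨ cong (_+_ (d x p)) py ⟨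
      d x p + d p y       ≡⟨ between ⟩
      d x y               ≤⟨ d-triangle x q y ⟩
      d x q + d q y       ∎))
    where open ℕP.≤-Reasoning

module ClassCount {n k : ℕ} (adj : Adjacency n) (simple : IsSimple adj)
  {d : Fin n → Fin n → ℕ} (isDist : IsDist adj d)
  (c : Fin n → Fin n → Fin k) (i : Fin k)
  (Θ-closed : ∀ (e f : Edge adj) → Θ d e f → c (src e) (tgt e) ≡ c (src f) (tgt f)) where

  open ShortestPaths adj simple isDist public
  open import Data.Integer using (_+_; _-_; _*_; _≤_; +≤+)

  not-Θ : ∀ {p q r s} → Edge? adj p q → Edge? adj r s → c p q ≢ c r s →
          d p r ℕ.+ d q s ≡ d p s ℕ.+ d r q
  not-Θ {p} {q} {r} {s} pq rs differ with d p r ℕ.+ d q s ℕP.≟ d p s ℕ.+ d r q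
  ... | yes balanced = balanced
  ... | no  Θpqrs    = contradiction (Θ-closed (edge p q pq) (edge r s rs) Θpqrs) differ

  c-sym : ∀ {a b} → Edge? adj a b → c b a ≡ c a b
  c-sym {a} {b} ab = Θ-closed (edge b a (adj-sym ab)) (edge a b ab) λ 2≡0 → contradiction (begin
    2               ≡⟨ cong₂ ℕ._+_ (d-adjacent (adj-sym ab)) (d-adjacent ab) ⟨
    d b a ℕ.+ d a b ≡⟨ 2≡0 ⟩
    d b b ℕ.+ d a a ≡⟨ cong₂ ℕ._+_ (d-refl b) (d-refl a) ⟩
    0               ∎) λ ()
    where open ≡-Reasoning

  χ : Fin n → Fin n → ℕ
  χ p q = if c p q == i then 1 else 0

  χ-F : ∀ {p q} → c p q ≡ i → χ p q ≡ 1
  χ-F F = cong (if_then 1 else 0) (≡⇒== F)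

  χ-not-F : ∀ {p q} → c p q ≢ i → χ p q ≡ 0
  χ-not-F notF = cong (if_then 1 else 0) (≢⇒==-false notF)

  χ≤1 : ∀ p q → χ p q ℕ.≤ 1
  χ≤1 p q with c p q == i
  ... | true  = ℕP.≤-refl
  ... | false = z≤n

  #F : ∀ {x y l} → Path x y l → ℕ
  #F []                = 0
  #F (_∷_ {p} {q} _ w) = χ p q ℕ.+ #F w

  sumʷ-χ : ∀ {x y l} (w : Path x y l) → sumʷ w (λ p q → + χ p q) ≡ + #F w
  sumʷ-χ []                = refl
  sumʷ-χ (_∷_ {p} {q} _ w) = cong (_+_ (+ χ p q)) (sumʷ-χ w)

  sumʷ-2χ : ∀ {x y l} (w : Path x y l) → sumʷ w (λ p q → + χ p q * + 2) ≡ + (#F w ℕ.* 2)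
  sumʷ-2χ w = trans (sumʷ-*ʳ w (+ 2) _)
                    (trans (cong (_* + 2) (sumʷ-χ w)) (sym (ℤP.pos-* (#F w) 2)))

  θ : Fin n → Fin n → Fin n → Fin n → ℤ
  θ p q r s = (+ d p s + + d q r) - (+ d p r + + d q s)

  θ-sym : ∀ p q r s → θ p q r s ≡ θ r s p q
  θ-sym p q r s = cong₂ _-_
    (trans (ℤP.+-comm (+ d p s) (+ d q r)) (cong₂ (λ a b → + a + + b) (d-sym q r) (d-sym p s)))
    (cong₂ (λ a b → + a + + b) (d-sym p r) (d-sym q s))

  θ-additive : ∀ p q r s t → θ p q r s + θ p q s t ≡ θ p q r t
  θ-additive p q r s t = additive (+ d p r) (+ d p s) (+ d p t) (+ d q r) (+ d q s) (+ d q t)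
    where
    additive : ∀ Pr Ps Pt Qr Qs Qt →
               ((Ps + Qr) - (Pr + Qs)) + ((Pt + Qs) - (Ps + Qt)) ≡ (Pt + Qr) - (Pr + Qt)
    additive = solve-∀

  sumʷ-θ : ∀ p q {s t l} (w : Path s t l) → sumʷ w (θ p q) ≡ θ p q s t
  sumʷ-θ p q {s}     []                 = sym (ℤP.+-inverseʳ (+ d p s + + d q s))
  sumʷ-θ p q {s} {t} (_∷_ {y = r} _ w) =
    trans (cong (_+_ (θ p q s r)) (sumʷ-θ p q w)) (θ-additive p q s r t)

  sumʷ-θ-first : ∀ {x y l} (P : Path x y l) r s → sumʷ P (λ p q → θ p q r s) ≡ θ x y r s
  sumʷ-θ-first {x} {y} P r s = begin
    sumʷ P (λ p q → θ p q r s) ≡⟨ sumʷ-cong P (λ {p} {q} _ → θ-sym p q r s) ⟩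
    sumʷ P (θ r s)             ≡⟨ sumʷ-θ r s P ⟩
    θ r s x y                  ≡⟨ θ-sym r s x y ⟩
    θ x y r s                  ∎
    where open ≡-Reasoning

  θ≡0-across-classes : ∀ {p q r s} → Edge? adj p q → Edge? adj r s → c p q ≢ c r s →
                       θ p q r s ≡ 0ℤ
  θ≡0-across-classes {p} {q} {r} {s} pq rs differ =
    trans (cong (_- (+ d p r + + d q s)) balanced) (ℤP.+-inverseʳ (+ d p r + + d q s))
    where
    balanced : + d p s + + d q r ≡ + d p r + + d q s
    balanced = cong +_ (trans (cong (ℕ._+_ (d p s)) (d-sym q r)) (sym (not-Θ pq rs differ)))

  χ-θ-compatible : ∀ {p q r s} → Edge? adj p q → Edge? adj r s →
                   + χ p q * θ p q r s ≡ + χ r s * θ p q r s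
  χ-θ-compatible {p} {q} {r} {s} pq rs with c p q ≟ c r s
  ... | yes same  = cong (λ j → + (if j == i then 1 else 0) * θ p q r s) same
  ... | no differ rewrite θ≡0-across-classes pq rs differ =
    trans (ℤP.*-zeroʳ (+ χ p q)) (sym (ℤP.*-zeroʳ (+ χ r s)))

  χθ-double-count : ∀ {x y s t k l} (P : Path x y k) (w : Path s t l) →
                    sumʷ P (λ p q → + χ p q * θ p q s t) ≡ sumʷ w (λ r s → + χ r s * θ x y r s)
  χθ-double-count {x} {y} {s} {t} P w = begin
    sumʷ P (λ p q → + χ p q * θ p q s t)
      ≡⟨ sumʷ-cong P (λ {p} {q} _ → cong (+ χ p q *_) (sym (sumʷ-θ p q w))) ⟩
    sumʷ P (λ p q → + χ p q * sumʷ w (θ p q))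
      ≡⟨ sumʷ-cong P (λ {p} {q} _ → sym (sumʷ-*ˡ w (+ χ p q) (θ p q))) ⟩
    sumʷ P (λ p q → sumʷ w (λ r s → + χ p q * θ p q r s))
      ≡⟨ sumʷ-cong P (λ pq → sumʷ-cong w (λ rs → χ-θ-compatible pq rs)) ⟩
    sumʷ P (λ p q → sumʷ w (λ r s → + χ r s * θ p q r s))
      ≡⟨ sumʷ-comm P w (λ p q r s → + χ r s * θ p q r s) ⟩
    sumʷ w (λ r s → sumʷ P (λ p q → + χ r s * θ p q r s))
      ≡⟨ sumʷ-cong w (λ {r} {s} _ → sumʷ-*ˡ P (+ χ r s) (λ p q → θ p q r s)) ⟩
    sumʷ w (λ r s → + χ r s * sumʷ P (λ p q → θ p q r s))
      ≡⟨ sumʷ-cong w (λ {r} {s} _ → cong (+ χ r s *_) (sumʷ-θ-first P r s)) ⟩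
    sumʷ w (λ r s → + χ r s * θ x y r s)
      ∎
    where open ≡-Reasoning

  θ≤2 : ∀ x y {r s} → Edge? adj r s → θ x y r s ≤ + 2
  θ≤2 x y {r} {s} rs =
    ℤP.≤-trans (ℤP.+-monoˡ-≤ (- (+ (d x r ℕ.+ d y s))) (+≤+ two-steps))
               (ℤP.≤-reflexive (cancel (+ 2) (+ (d x r ℕ.+ d y s))))
    where
    open import Data.Integer using (-_)
    cancel : ∀ a b → (a + b) - b ≡ a
    cancel = solve-∀
    two-steps : d x s ℕ.+ d y r ℕ.≤ 2 ℕ.+ (d x r ℕ.+ d y s)
    two-steps = ℕP.≤-trans (ℕP.+-mono-≤ (d-lipschitz x rs) (d-lipschitz y (adj-sym rs)))
                           (ℕP.≤-reflexive (cong suc (ℕP.+-suc (d x r) (d y s))))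

  θ-on-geodesic : ∀ {x p y k} → d x p ℕ.+ d p y ≡ d x y → (P : Path p y k) → k ≡ d p y →
                  sumʷ P (λ a b → + χ a b * θ a b x y) ≡ sumʷ P (λ a b → + χ a b * + 2)
  θ-on-geodesic between []                                 _   = refl
  θ-on-geodesic {x} {p} {y} between (_∷_ {y = q} pq P) sk≡ =
    cong₂ _+_ (cong (+ χ p q *_) θ≡2) (θ-on-geodesic between′ P k≡)
    where
    open ≡-Reasoning
    k≡ = geodesic-tail pq P sk≡
    py : d p y ≡ suc (d q y)
    py = trans (sym sk≡) (cong suc k≡)
    xq : d x q ≡ suc (d x p)
    xq = between-step between pq py
    between′ : d x q ℕ.+ d q y ≡ d x y
    between′ = begin
      d x q ℕ.+ d q y       ≡⟨ cong (ℕ._+ d q y) xq ⟩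
      suc (d x p) ℕ.+ d q y ≡⟨ ℕP.+-suc (d x p) (d q y) ⟨
      d x p ℕ.+ suc (d q y) ≡⟨ cong (ℕ._+_ (d x p)) py ⟨
      d x p ℕ.+ d p y       ≡⟨ between ⟩
      d x y                 ∎
    two : ∀ X Y → ((1ℤ + Y) + (1ℤ + X)) - (X + Y) ≡ + 2
    two = solve-∀
    θ≡2 : θ p q x y ≡ + 2
    θ≡2 = trans (cong₂ (λ a b → (+ a + + b) - (+ d p x + + d q y))
                       py (trans (d-sym q x) (trans xq (cong suc (d-sym x p)))))
                (two (+ d p x) (+ d q y))

  geodesic-#F-formula : ∀ {x y k l} (P : Path x y k) → k ≡ d x y → (w : Path x y l) →
                        + (#F P ℕ.* 2) ≡ sumʷ w (λ r s → + χ r s * θ x y r s)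
  geodesic-#F-formula {x} {y} P k≡ w = begin
    + (#F P ℕ.* 2)                       ≡⟨ sumʷ-2χ P ⟨
    sumʷ P (λ a b → + χ a b * + 2)       ≡⟨ θ-on-geodesic (cong (ℕ._+ d x y) (d-refl x)) P k≡ ⟨
    sumʷ P (λ a b → + χ a b * θ a b x y) ≡⟨ χθ-double-count P w ⟩
    sumʷ w (λ r s → + χ r s * θ x y r s) ∎
    where open ≡-Reasoning

  sumʷ-χθ≤2#F : ∀ x y {s t l} (w : Path s t l) →
                sumʷ w (λ r s → + χ r s * θ x y r s) ≤ + (#F w ℕ.* 2)
  sumʷ-χθ≤2#F x y w = ℤP.≤-trans
    (sumʷ-mono-≤ w λ {r} {s} rs → ℤP.*-monoˡ-≤-nonNeg (+ χ r s) (θ≤2 x y rs))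
    (ℤP.≤-reflexive (sumʷ-2χ w))

  geodesic-#F-minimal : ∀ {x y k l} (P : Path x y k) → k ≡ d x y → (w : Path x y l) →
                        #F P ℕ.≤ #F w
  geodesic-#F-minimal {x} {y} P k≡ w = ℕP.*-cancelʳ-≤ (#F P) (#F w) 2 (ℤP.drop‿+≤+
    (subst (_≤ + (#F w ℕ.* 2)) (sym (geodesic-#F-formula P k≡ w)) (sumʷ-χθ≤2#F x y w)))

  geodesic-#F-across-level-F-edge :
    ∀ {a b z k l} → Edge? adj a b → c a b ≡ i → d a z ≡ d b z →
    (Pa : Path a z k) → k ≡ d a z → (w : Path b z l) → #F Pa ℕ.≤ #F w
  geodesic-#F-across-level-F-edge {a} {b} {z} ab F level Pa k≡ w =
    ℕP.≤-pred (ℕP.*-cancelʳ-< 2 (#F Pa) (suc (#F w)) (s≤s (ℤP.drop‿+≤+ bound)))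
    where
    one : ∀ D → (1ℤ + D) - (0ℤ + D) ≡ 1ℤ
    one = solve-∀
    first-step : + χ a b * θ a z a b ≡ 1ℤ
    first-step = begin
      + χ a b * θ a z a b                       ≡⟨ cong (λ j → + j * θ a z a b) (χ-F F) ⟩
      1ℤ * θ a z a b                            ≡⟨ ℤP.*-identityˡ (θ a z a b) ⟩
      (+ d a b + + d z a) - (+ d a a + + d z b) ≡⟨ cong₂ (λ e f → (+ e + + d z a) - (+ f + + d z b))
                                                         (d-adjacent ab) (d-refl a) ⟩
      (1ℤ + + d z a) - (0ℤ + + d z b)           ≡⟨ cong (λ e → (1ℤ + + d z a) - (0ℤ + + e))
                                                        (trans (d-sym z b) (trans (sym level) (d-sym a z))) ⟩
      (1ℤ + + d z a) - (0ℤ + + d z a)           ≡⟨ one (+ d z a) ⟩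
      1ℤ                                        ∎
      where open ≡-Reasoning
    bound : + (#F Pa ℕ.* 2) ≤ + suc (#F w ℕ.* 2)
    bound = begin
      + (#F Pa ℕ.* 2)
        ≡⟨ geodesic-#F-formula Pa k≡ (ab ∷ w) ⟩
      + χ a b * θ a z a b + sumʷ w (λ r s → + χ r s * θ a z r s)
        ≤⟨ ℤP.+-mono-≤ (ℤP.≤-reflexive first-step) (sumʷ-χθ≤2#F a z w) ⟩
      1ℤ + + (#F w ℕ.* 2)
        ∎
      where open ℤP.≤-Reasoning

+-suc-swap : ∀ {p q P Q} → q ≡ suc p → Q ≡ suc P → p ℕ.+ Q ≡ q ℕ.+ P
+-suc-swap {p} refl refl = ℕP.+-suc p _

module _ {I : Set} (f F : I → ℕ) {x y : I} {s t : ℕ} where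

  open import Data.Nat using (_+_)
  open CommutativeSemigroupProperties ℕP.+-commutativeSemigroup
    using (xy∙z≈xz∙y; xy∙z≈y∙xz; x∙yz≈xz∙y)

  ⊓-shift : f x + s ≡ F x + t → f y + s ≡ F y + t → (f x ⊓ f y) + s ≡ (F x ⊓ F y) + t
  ⊓-shift fx fy = trans (ℕP.+-distribʳ-⊓ s (f x) (f y))
                        (trans (cong₂ _⊓_ fx fy) (sym (ℕP.+-distribʳ-⊓ t (F x) (F y))))

  <ᵇ-shift : f x + s ≡ F x + t → f y + s ≡ F y + t → (f x <ᵇ f y) ≡ (F x <ᵇ F y)
  <ᵇ-shift fx fy = ⇔→≡ (mk⇔ (transport (f x) (f y) (F x) (F y) fx fy)
                            (transport (F x) (F y) (f x) (f y) (sym fx) (sym fy)))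
    where
    open Equivalence
    transport : ∀ a b A B {s t} → a + s ≡ A + t → b + s ≡ B + t →
                (a <ᵇ b) ≡ true → (A <ᵇ B) ≡ true
    transport a b A B {s} {t} as≡At bs≡Bt a<b = from (<ᵇ≡true⇔< {A} {B})
      (ℕP.+-cancelʳ-< t A B
        (subst₂ _<_ as≡At bs≡Bt (ℕP.+-monoˡ-< s (to (<ᵇ≡true⇔< {a} {b}) a<b))))

  shift-trans : f x + F y ≡ f y + F x → f x + s ≡ F x + t → f y + s ≡ F y + t
  shift-trans fxFy≡fyFx fx = ℕP.+-cancelʳ-≡ (F x) (f y + s) (F y + t) (begin
    (f y + s) + F x ≡⟨ xy∙z≈xz∙y (f y) s (F x) ⟩
    (f y + F x) + s ≡⟨ cong (_+ s) fxFy≡fyFx ⟨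
    (f x + F y) + s ≡⟨ xy∙z≈y∙xz (f x) (F y) s ⟩
    F y + (f x + s) ≡⟨ cong (_+_ (F y)) fx ⟩
    F y + (F x + t) ≡⟨ x∙yz≈xz∙y (F y) (F x) t ⟩
    (F y + t) + F x ∎)
    where open ≡-Reasoning

<ᵇ-cong-diff : ∀ {I : Set} (f F : I → ℕ) {x y} →
               f x ℕ.+ F y ≡ f y ℕ.+ F x → (f x <ᵇ f y) ≡ (F x <ᵇ F y)
<ᵇ-cong-diff f F {x} {y} fxFy≡fyFx =
  <ᵇ-shift f F (trans fxFy≡fyFx (ℕP.+-comm (f y) (F x))) (ℕP.+-comm (f y) (F y))

module QuotientDistance {n k m : ℕ} (adj : Adjacency n) (simple : IsSimple adj)
  {d : Fin n → Fin n → ℕ} (isDist : IsDist adj d)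
  (c : Fin n → Fin n → Fin k) (i : Fin k)
  (Θ-closed : ∀ (e f : Edge adj) → Θ d e f → c (src e) (tgt e) ≡ c (src f) (tgt f))
  {ℓ : Fin n → Fin m} (component : IsComponentMap adj c i ℓ)
  {dQ : Fin m → Fin m → ℕ} (isDistQ : IsDist (quotAdj adj ℓ) dQ) where

  open import Data.Nat using (_+_; _≤_)
  open ClassCount adj simple isDist c i Θ-closed public
  module Q = ShortestPaths (quotAdj adj ℓ) (quotAdj-simple adj ℓ simple) isDistQ

  non-F-edge-internal : ∀ {p q} → Edge? adj p q → c p q ≢ i → ℓ p ≡ ℓ q
  non-F-edge-internal {p} {q} pq notF = proj₁ (proj₂ component) p q (1 , (pq , notF) ∷ [])

  dQ≤χ : ∀ {p q} → Edge? adj p q → dQ (ℓ p) (ℓ q) ≤ χ p q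
  dQ≤χ {p} {q} pq with c p q ≟ i | ℓ p ≟ ℓ q
  ... | _       | yes same  =
    subst (_≤ _) (sym (trans (cong (dQ (ℓ p)) (sym same)) (Q.d-refl (ℓ p)))) z≤n
  ... | yes _   | no differ = ℕP.≤-reflexive (Q.d-adjacent (quotAdj-intro adj ℓ differ pq refl refl))
  ... | no notF | no differ = contradiction (non-F-edge-internal pq notF) differ

  dQ≤#F : ∀ {x y l} (w : Path x y l) → dQ (ℓ x) (ℓ y) ≤ #F w
  dQ≤#F {x}     []                 = ℕP.≤-reflexive (Q.d-refl (ℓ x))
  dQ≤#F {x} {y} (_∷_ {y = q} xq w) =
    ℕP.≤-trans (Q.d-triangle (ℓ x) (ℓ q) (ℓ y)) (ℕP.+-mono-≤ (dQ≤χ xq) (dQ≤#F w))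

  #F-avoiding : ∀ {x y l} (w : Walk (MinusAdj adj c i) x y l) → #F (mapʷ proj₁ w) ≡ 0
  #F-avoiding []               = refl
  #F-avoiding ((_ , notF) ∷ w) = cong₂ _+_ (χ-not-F notF) (#F-avoiding w)

  #F-++ : ∀ {x y z l l′} (v : Path x y l) (w : Path y z l′) → #F (v ++ʷ w) ≡ #F v + #F w
  #F-++ []                w = refl
  #F-++ (_∷_ {p} {q} _ v) w =
    trans (cong (_+_ (χ p q)) (#F-++ v w)) (sym (ℕP.+-assoc (χ p q) (#F v) (#F w)))

  #F-detour : ∀ {x p q y l l′} (v : Walk (MinusAdj adj c i) x p l) (pq : Edge? adj p q)
              (w : Path q y l′) → #F (mapʷ proj₁ v ++ʷ (pq ∷ w)) ≤ suc (#F w)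
  #F-detour {p = p} {q} v pq w = begin
    #F (mapʷ proj₁ v ++ʷ (pq ∷ w))  ≡⟨ #F-++ (mapʷ proj₁ v) (pq ∷ w) ⟩
    #F (mapʷ proj₁ v) + #F (pq ∷ w) ≡⟨ cong (_+ #F (pq ∷ w)) (#F-avoiding v) ⟩
    χ p q + #F w                    ≤⟨ ℕP.+-monoˡ-≤ (#F w) (χ≤1 p q) ⟩
    suc (#F w)                      ∎
    where open ℕP.≤-Reasoning

  lift-walk : ∀ {X Y k′} → Walk (Edge? (quotAdj adj ℓ)) X Y k′ →
              ∀ {x y} → ℓ x ≡ X → ℓ y ≡ Y → ∃ λ l → Σ (Path x y l) λ w → #F w ≤ k′
  lift-walk [] {x} {y} xX yY with l , v ← proj₁ component x y (trans xX (sym yY)) =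
    l , mapʷ proj₁ v , ℕP.≤-reflexive (#F-avoiding v)
  lift-walk (XZ ∷ W) {x} xX yY
    with _ , p , q , pq , pX , qZ ← quotAdj-elim adj ℓ XZ
    with _ , w , #Fw≤ ← lift-walk W qZ yY
    with _ , v ← proj₁ component x p (trans xX (sym pX))
    = _ , mapʷ proj₁ v ++ʷ (pq ∷ w) , ℕP.≤-trans (#F-detour v pq w) (s≤s #Fw≤)

  geodesic-#F≡dQ : ∀ {x y k′} (P : Path x y k′) → k′ ≡ d x y → #F P ≡ dQ (ℓ x) (ℓ y)
  geodesic-#F≡dQ {x} {y} P k≡ with _ , w , #Fw≤ ← lift-walk (Q.geodesic (ℓ x) (ℓ y)) refl refl =
    ℕP.≤-antisym (ℕP.≤-trans (geodesic-#F-minimal P k≡ w) #Fw≤) (dQ≤#F P)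

  F-edge-gap-< : ∀ {a b} z → Edge? adj a b → c a b ≡ i → d a z < d b z →
                 d a z + dQ (ℓ b) (ℓ z) ≡ d b z + dQ (ℓ a) (ℓ z)
  F-edge-gap-< {a} {b} z ab F a<b = +-suc-swap bz (begin
    dQ (ℓ b) (ℓ z)            ≡⟨ geodesic-#F≡dQ (adj-sym ab ∷ geodesic a z) (sym bz) ⟨
    χ b a + #F (geodesic a z) ≡⟨ cong₂ _+_ (χ-F (trans (c-sym ab) F))
                                           (geodesic-#F≡dQ (geodesic a z) refl) ⟩
    suc (dQ (ℓ a) (ℓ z))      ∎)
    where
    open ≡-Reasoning
    bz = d-step z ab a<b

  dQ-level : ∀ {a b} z → Edge? adj a b → c a b ≡ i → d a z ≡ d b z →
             dQ (ℓ a) (ℓ z) ≤ dQ (ℓ b) (ℓ z)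
  dQ-level {a} {b} z ab F level = subst₂ _≤_
    (geodesic-#F≡dQ (geodesic a z) refl) (geodesic-#F≡dQ (geodesic b z) refl)
    (geodesic-#F-across-level-F-edge ab F level (geodesic a z) refl (geodesic b z))

  F-edge-gap : ∀ {a b} → Edge? adj a b → c a b ≡ i →
               ∀ z → d a z + dQ (ℓ b) (ℓ z) ≡ d b z + dQ (ℓ a) (ℓ z)
  F-edge-gap {a} {b} ab F z with ℕP.<-cmp (d a z) (d b z)
  ... | tri< a<b _ _ = F-edge-gap-< z ab F a<b
  ... | tri≈ _ a≡b _ = cong₂ _+_ a≡b (ℕP.≤-antisym
                         (dQ-level z (adj-sym ab) (trans (c-sym ab) F) (sym a≡b))
                         (dQ-level z ab F a≡b))
  ... | tri> _ _ b<a = sym (F-edge-gap-< z (adj-sym ab) (trans (c-sym ab) F) b<a)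

  F-edge-crossing : ∀ {x y} → Edge? adj x y → c x y ≡ i → ℓ x ≢ ℓ y
  F-edge-crossing {x} {y} xy F same = contradiction (begin
    1                      ≡⟨ cong₂ _+_ (d-adjacent xy) (Q.d-refl (ℓ y)) ⟨
    d x y + dQ (ℓ y) (ℓ y) ≡⟨ F-edge-gap xy F y ⟩
    d y y + dQ (ℓ x) (ℓ y) ≡⟨ cong₂ _+_ (d-refl y)
                                        (trans (cong (λ X → dQ X (ℓ y)) same) (Q.d-refl (ℓ y))) ⟩
    0                      ∎) λ ()
    where open ≡-Reasoning

  crossing-F-edge : ∀ {x y} → Edge? adj x y → ℓ x ≢ ℓ y → c x y ≡ i
  crossing-F-edge {x} {y} xy differ with c x y ≟ i
  ... | yes F    = F
  ... | no  notF = contradiction (non-F-edge-internal xy notF) differ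

open import Data.Rational using (ℚ; 0ℚ; _+_; _≤_)
import Data.Rational.Properties as ℚP
open import Algebra.Properties.CommutativeMonoid.Sum ℚP.+-0-commutativeMonoid
  using (sum; sum-cong-≗; sum-replicate-zero; sum-remove; ∑-comm; ∑-distrib-+)

[_]·_ : Bool → ℚ → ℚ
[ b ]· r = if b then r else 0ℚ

infixr 7 [_]·_

sumFin≡sum : ∀ {n} (f : Fin n → ℚ) → sumFin f ≡ sum f
sumFin≡sum {zero}  f = refl
sumFin≡sum {suc n} f = cong (_+_ (f zero)) (sumFin≡sum (f ∘ suc))

sumFin²≡sum² : ∀ {a b} (f : Fin a → Fin b → ℚ) →
               sumFin (λ x → sumFin (f x)) ≡ sum (λ x → sum (f x))
sumFin²≡sum² f = trans (sumFin≡sum (λ x → sumFin (f x))) (sum-cong-≗ λ x → sumFin≡sum (f x))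

sum-zero : ∀ {n} {f : Fin n → ℚ} → (∀ j → f j ≡ 0ℚ) → sum f ≡ 0ℚ
sum-zero {n} f≡0 = trans (sum-cong-≗ f≡0) (sum-replicate-zero n)

∑-comm₁₂ : ∀ {a b e} (f : Fin a → Fin b → Fin e → ℚ) →
           sum (λ X → sum (λ x → sum (λ y → f X x y))) ≡
           sum (λ x → sum (λ y → sum (λ X → f X x y)))
∑-comm₁₂ f = trans (∑-comm (λ X x → sum (f X x)))
                   (sum-cong-≗ λ x → ∑-comm (λ X y → f X x y))

∑-comm₂₂ : ∀ {a a′ b e} (f : Fin a → Fin a′ → Fin b → Fin e → ℚ) →
           sum (λ X → sum (λ Y → sum (λ x → sum (λ y → f X Y x y)))) ≡
           sum (λ x → sum (λ y → sum (λ X → sum (λ Y → f X Y x y))))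
∑-comm₂₂ f = trans (sum-cong-≗ λ X → ∑-comm₁₂ (f X))
                   (∑-comm₁₂ λ X x y → sum (λ Y → f X Y x y))

∑-distrib-+² : ∀ {a b} (f g : Fin a → Fin b → ℚ) →
               sum (λ x → sum (λ y → f x y + g x y)) ≡
               sum (λ x → sum (f x)) + sum (λ x → sum (g x))
∑-distrib-+² f g = trans (sum-cong-≗ λ x → ∑-distrib-+ (f x) (g x))
                         (∑-distrib-+ (λ x → sum (f x)) (λ x → sum (g x)))

[]·-zeroʳ : ∀ b → [ b ]· 0ℚ ≡ 0ℚ
[]·-zeroʳ true  = refl
[]·-zeroʳ false = refl

[]·-false : ∀ {b} r → ¬ b ≡ true → [ b ]· r ≡ 0ℚ
[]·-false {true}  r b≢true = contradiction refl b≢true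
[]·-false {false} r _      = refl

[]·-exclusive : ∀ {b c} r → (b ≡ true → c ≡ true → ⊥) → [ b ]· [ c ]· r ≡ 0ℚ
[]·-exclusive {true}  {true}  r exclusive = contradiction refl (exclusive refl)
[]·-exclusive {true}  {false} r _         = refl
[]·-exclusive {false}         r _         = refl

[]·-∧ : ∀ b c r → [ b ∧ c ]· r ≡ [ b ]· [ c ]· r
[]·-∧ true  c r = refl
[]·-∧ false c r = refl

[]·-comm : ∀ b c r → [ b ]· [ c ]· r ≡ [ c ]· [ b ]· r
[]·-comm true  true  r = refl
[]·-comm true  false r = refl
[]·-comm false true  r = refl
[]·-comm false false r = refl

[]·-+ : ∀ b r s → [ b ]· (r + s) ≡ [ b ]· r + [ b ]· s
[]·-+ true  r s = refl
[]·-+ false r s = sym (ℚP.+-identityʳ 0ℚ)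

[]·-∨ : ∀ {b c} r → (b ≡ true → c ≡ true → ⊥) → [ b ∨ c ]· r ≡ [ b ]· r + [ c ]· r
[]·-∨ {true}  {true}  r exclusive = contradiction refl (exclusive refl)
[]·-∨ {true}  {false} r _         = sym (ℚP.+-identityʳ r)
[]·-∨ {false}         r _         = sym (ℚP.+-identityˡ _)

[]·-sum : ∀ {n} b (f : Fin n → ℚ) → [ b ]· sum f ≡ sum (λ j → [ b ]· f j)
[]·-sum     true  f = refl
[]·-sum {n} false f = sym (sum-replicate-zero n)

[]·-sumFin² : ∀ {a b} c (f : Fin a → Fin b → ℚ) →
              [ c ]· sumFin (λ x → sumFin (f x)) ≡ sum (λ x → sum (λ y → [ c ]· f x y))
[]·-sumFin² c f = trans (cong ([ c ]·_) (sumFin²≡sum² f))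
                        (trans ([]·-sum c (λ x → sum (f x))) (sum-cong-≗ λ x → []·-sum c (f x)))

[]·-orientations : ∀ {m} {X Y : Fin m} p r → X ≢ Y →
                   [ (toℕ X <ᵇ toℕ Y) ∧ p ]· r + [ (toℕ Y <ᵇ toℕ X) ∧ p ]· r ≡ [ p ]· r
[]·-orientations {X = X} {Y} p r X≢Y with ℕP.<-cmp (toℕ X) (toℕ Y)
... | tri< X<Y _ Y≮X =
  trans (cong₂ (λ a b → [ a ∧ p ]· r + [ b ∧ p ]· r)
               (from <ᵇ≡true⇔< X<Y) (¬-not (Y≮X ∘ to <ᵇ≡true⇔<)))
        (ℚP.+-identityʳ ([ p ]· r))
  where open Equivalence
... | tri≈ _ X≡Y _   = contradiction (toℕ-injective X≡Y) X≢Y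
... | tri> X≮Y _ Y<X =
  trans (cong₂ (λ a b → [ a ∧ p ]· r + [ b ∧ p ]· r)
               (¬-not (X≮Y ∘ to <ᵇ≡true⇔<)) (from <ᵇ≡true⇔< Y<X))
        (ℚP.+-identityˡ ([ p ]· r))
  where open Equivalence

sum-point : ∀ {n} (a₀ : Fin n) (f : Fin n → ℚ) → sum (λ a → [ a₀ == a ]· f a) ≡ f a₀
sum-point {suc n} a₀ f = begin
  sum (λ a → [ a₀ == a ]· f a)
    ≡⟨ sum-remove {i = a₀} (λ a → [ a₀ == a ]· f a) ⟩
  [ a₀ == a₀ ]· f a₀ + sum (λ j → [ a₀ == punchIn a₀ j ]· f (punchIn a₀ j))
    ≡⟨ cong₂ _+_ (cong ([_]· f a₀) (≡⇒== {X = a₀} refl))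
                 (sum-zero λ j → []·-false (f (punchIn a₀ j)) λ h →
                    punchInᵢ≢i a₀ j (sym (==⇒≡ h))) ⟩
  f a₀ + 0ℚ
    ≡⟨ ℚP.+-identityʳ (f a₀) ⟩
  f a₀ ∎
  where open ≡-Reasoning

sum-point² : ∀ {m} (X₀ Y₀ : Fin m) (g : Fin m → Fin m → ℚ) →
             sum (λ X → sum (λ Y → [ (X₀ == X) ∧ (Y₀ == Y) ]· g X Y)) ≡ g X₀ Y₀
sum-point² X₀ Y₀ g = begin
  sum (λ X → sum (λ Y → [ (X₀ == X) ∧ (Y₀ == Y) ]· g X Y))
    ≡⟨ sum-cong-≗ (λ X → sum-cong-≗ λ Y → []·-∧ (X₀ == X) (Y₀ == Y) (g X Y)) ⟩
  sum (λ X → sum (λ Y → [ X₀ == X ]· [ Y₀ == Y ]· g X Y))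
    ≡⟨ sum-cong-≗ (λ X → sym ([]·-sum (X₀ == X) λ Y → [ Y₀ == Y ]· g X Y)) ⟩
  sum (λ X → [ X₀ == X ]· sum (λ Y → [ Y₀ == Y ]· g X Y))
    ≡⟨ sum-cong-≗ (λ X → cong ([ X₀ == X ]·_) (sum-point Y₀ (g X))) ⟩
  sum (λ X → [ X₀ == X ]· g X Y₀)
    ≡⟨ sum-point X₀ (λ X → g X Y₀) ⟩
  g X₀ Y₀ ∎
  where open ≡-Reasoning

module QuotientSum {n m : ℕ} (adj : Adjacency n) (adj-sym : ∀ x y → adj x y ≡ adj y x)
  (ℓ : Fin n → Fin m) (PN : Fin m → Bool)
  (PQ : Fin m → Fin m → Bool) (PQ-sym : ∀ X Y → PQ X Y ≡ PQ Y X)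
  (Pg : Fin n → Fin n → Bool)
  (internal : ∀ {x y} → Edge? adj x y → ℓ x ≡ ℓ y → Pg x y ≡ PN (ℓ x))
  (crossing : ∀ {x y} → Edge? adj x y → ℓ x ≢ ℓ y → Pg x y ≡ PQ (ℓ x) (ℓ y)) where

  lt : ∀ {N} → Fin N → Fin N → Bool
  lt x y = toℕ x <ᵇ toℕ y

  counted : Fin m → Fin m → Bool
  counted X Y = quotAdj adj ℓ X Y ∧ lt X Y ∧ PQ X Y

  links : Fin n → Fin n → Fin m → Fin m → Bool
  links x y X Y = ((ℓ x == X) ∧ (ℓ y == Y)) ∨ ((ℓ x == Y) ∧ (ℓ y == X))

  internal-split : ∀ {x y} → Edge? adj x y → ℓ x ≡ ℓ y → ∀ r →
    [ Pg x y ]· r ≡ sum (λ X → [ PN X ]· [ (ℓ x == X) ∧ (ℓ y == X) ]· r)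
                  + sum (λ X → sum (λ Y → [ counted X Y ]· [ links x y X Y ]· r))
  internal-split {x} {y} xy same r = begin
    [ Pg x y ]· r                         ≡⟨ cong ([_]· r) (internal xy same) ⟩
    [ PN (ℓ x) ]· r                       ≡⟨ sum-point (ℓ x) (λ X → [ PN X ]· r) ⟨
    sum (λ X → [ ℓ x == X ]· [ PN X ]· r) ≡⟨ sum-cong-≗ same-fibre ⟩
    vertex-part                           ≡⟨ ℚP.+-identityʳ vertex-part ⟨
    vertex-part + 0ℚ                      ≡⟨ cong (_+_ vertex-part)
                                                  (sum-zero λ X → sum-zero (no-link X)) ⟨
    vertex-part + sum (λ X → sum (λ Y → [ counted X Y ]· [ links x y X Y ]· r)) ∎
    where
    open ≡-Reasoning
    vertex-part = sum (λ X → [ PN X ]· [ (ℓ x == X) ∧ (ℓ y == X) ]· r)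
    same-fibre : ∀ X → [ ℓ x == X ]· [ PN X ]· r ≡ [ PN X ]· [ (ℓ x == X) ∧ (ℓ y == X) ]· r
    same-fibre X = trans ([]·-comm (ℓ x == X) (PN X) r) (cong (λ b → [ PN X ]· [ b ]· r)
      (sym (trans (cong (λ Z → (ℓ x == X) ∧ (Z == X)) (sym same)) (∧-idem (ℓ x == X)))))
    links⇒≡ : ∀ {X Y} → links x y X Y ≡ true → X ≡ Y
    links⇒≡ h with ∨-true h
    ... | inj₁ xXyY = let xX , yY = ∧-true xXyY in trans (sym (==⇒≡ xX)) (trans same (==⇒≡ yY))
    ... | inj₂ xYyX = let xY , yX = ∧-true xYyX in trans (sym (==⇒≡ yX)) (trans (sym same) (==⇒≡ xY))
    no-link : ∀ X Y → [ counted X Y ]· [ links x y X Y ]· r ≡ 0ℚ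
    no-link X Y = []·-exclusive {counted X Y} {links x y X Y} r λ cXY lXY →
      proj₁ (quotAdj-elim adj ℓ (proj₁ (∧-true cXY))) (links⇒≡ lXY)

  both-orientations : ∀ {x y} → Edge? adj x y → ℓ x ≢ ℓ y → ∀ r →
    [ counted (ℓ x) (ℓ y) ]· r + [ counted (ℓ y) (ℓ x) ]· r ≡ [ PQ (ℓ x) (ℓ y) ]· r
  both-orientations {x} {y} xy differ r = begin
    [ counted X Y ]· r + [ counted Y X ]· r
      ≡⟨ cong₂ (λ a b → [ a ∧ lt X Y ∧ PQ X Y ]· r + [ b ∧ lt Y X ∧ PQ Y X ]· r)
               (quotAdj-intro adj ℓ differ xy refl refl)
               (quotAdj-intro adj ℓ (differ ∘ sym) (trans (adj-sym y x) xy) refl refl) ⟩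
    [ lt X Y ∧ PQ X Y ]· r + [ lt Y X ∧ PQ Y X ]· r
      ≡⟨ cong (λ p → [ lt X Y ∧ PQ X Y ]· r + [ lt Y X ∧ p ]· r) (PQ-sym Y X) ⟩
    [ lt X Y ∧ PQ X Y ]· r + [ lt Y X ∧ PQ X Y ]· r
      ≡⟨ []·-orientations (PQ X Y) r differ ⟩
    [ PQ X Y ]· r ∎
    where
    open ≡-Reasoning
    X = ℓ x
    Y = ℓ y

  links-split : ∀ {x y} → ℓ x ≢ ℓ y → ∀ X Y r →
      [ (ℓ x == X) ∧ (ℓ y == Y) ]· [ counted X Y ]· r
    + [ (ℓ y == X) ∧ (ℓ x == Y) ]· [ counted X Y ]· r
    ≡ [ counted X Y ]· [ links x y X Y ]· r
  links-split {x} {y} differ X Y r = begin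
    [ xXyY ]· [ counted X Y ]· r + [ yXxY ]· [ counted X Y ]· r
      ≡⟨ cong₂ _+_ ([]·-comm xXyY (counted X Y) r)
                   (trans ([]·-comm yXxY (counted X Y) r)
                          (cong (λ b → [ counted X Y ]· [ b ]· r) (∧-comm (ℓ y == X) (ℓ x == Y)))) ⟩
    [ counted X Y ]· [ xXyY ]· r + [ counted X Y ]· [ xYyX ]· r
      ≡⟨ []·-+ (counted X Y) ([ xXyY ]· r) ([ xYyX ]· r) ⟨
    [ counted X Y ]· ([ xXyY ]· r + [ xYyX ]· r)
      ≡⟨ cong ([ counted X Y ]·_) ([]·-∨ r λ h h′ → differ
           (trans (==⇒≡ (proj₁ (∧-true h))) (sym (==⇒≡ (proj₂ (∧-true {ℓ x == Y} h′)))))) ⟨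
    [ counted X Y ]· [ links x y X Y ]· r ∎
    where
    open ≡-Reasoning
    xXyY = (ℓ x == X) ∧ (ℓ y == Y)
    yXxY = (ℓ y == X) ∧ (ℓ x == Y)
    xYyX = (ℓ x == Y) ∧ (ℓ y == X)

  crossing-split : ∀ {x y} → Edge? adj x y → ℓ x ≢ ℓ y → ∀ r →
    [ Pg x y ]· r ≡ sum (λ X → [ PN X ]· [ (ℓ x == X) ∧ (ℓ y == X) ]· r)
                  + sum (λ X → sum (λ Y → [ counted X Y ]· [ links x y X Y ]· r))
  crossing-split {x} {y} xy differ r = begin
    [ Pg x y ]· r
      ≡⟨ cong ([_]· r) (crossing xy differ) ⟩
    [ PQ (ℓ x) (ℓ y) ]· r
      ≡⟨ both-orientations xy differ r ⟨
    [ counted (ℓ x) (ℓ y) ]· r + [ counted (ℓ y) (ℓ x) ]· r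
      ≡⟨ cong₂ _+_ (sum-point² (ℓ x) (ℓ y) (λ X Y → [ counted X Y ]· r))
                   (sum-point² (ℓ y) (ℓ x) (λ X Y → [ counted X Y ]· r)) ⟨
    sum (λ X → sum (λ Y → [ (ℓ x == X) ∧ (ℓ y == Y) ]· [ counted X Y ]· r))
      + sum (λ X → sum (λ Y → [ (ℓ y == X) ∧ (ℓ x == Y) ]· [ counted X Y ]· r))
      ≡⟨ ∑-distrib-+² (λ X Y → [ (ℓ x == X) ∧ (ℓ y == Y) ]· [ counted X Y ]· r)
                      (λ X Y → [ (ℓ y == X) ∧ (ℓ x == Y) ]· [ counted X Y ]· r) ⟨
    sum (λ X → sum (λ Y → [ (ℓ x == X) ∧ (ℓ y == Y) ]· [ counted X Y ]· r
                        + [ (ℓ y == X) ∧ (ℓ x == Y) ]· [ counted X Y ]· r))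
      ≡⟨ sum-cong-≗ (λ X → sum-cong-≗ λ Y → links-split differ X Y r) ⟩
    edge-part
      ≡⟨ ℚP.+-identityˡ edge-part ⟨
    0ℚ + edge-part
      ≡⟨ cong (_+ edge-part) (sum-zero no-vertex) ⟨
    sum (λ X → [ PN X ]· [ (ℓ x == X) ∧ (ℓ y == X) ]· r) + edge-part ∎
    where
    open ≡-Reasoning
    edge-part = sum (λ X → sum (λ Y → [ counted X Y ]· [ links x y X Y ]· r))
    no-vertex : ∀ X → [ PN X ]· [ (ℓ x == X) ∧ (ℓ y == X) ]· r ≡ 0ℚ
    no-vertex X = trans (cong ([ PN X ]·_) ([]·-false r λ h →
                          let xX , yX = ∧-true h in differ (trans (==⇒≡ xX) (sym (==⇒≡ yX)))))
                        ([]·-zeroʳ (PN X))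

  non-edge-split :
    sum (λ X → [ PN X ]· 0ℚ) + sum (λ X → sum (λ Y → [ counted X Y ]· 0ℚ)) ≡ 0ℚ
  non-edge-split = trans (cong₂ _+_ (sum-zero λ X → []·-zeroʳ (PN X))
                                    (sum-zero λ X → sum-zero λ Y → []·-zeroʳ (counted X Y)))
                         (ℚP.+-identityʳ 0ℚ)

  edge-split : ∀ (w : Fin n → Fin n → ℚ) x y →
    [ adj x y ∧ lt x y ∧ Pg x y ]· w x y
      ≡ sum (λ X → [ PN X ]· [ adj x y ∧ lt x y ∧ ((ℓ x == X) ∧ (ℓ y == X)) ]· w x y)
      + sum (λ X → sum (λ Y → [ counted X Y ]· [ adj x y ∧ lt x y ∧ links x y X Y ]· w x y))
  edge-split w x y with adj x y in xy | lt x y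
  ... | false | _     = sym non-edge-split
  ... | true  | false = sym non-edge-split
  ... | true  | true  with ℓ x ≟ ℓ y
  ...   | yes same   = internal-split xy same (w x y)
  ...   | no  differ = crossing-split xy differ (w x y)

  sumEdges-quotient : ∀ (w : Fin n → Fin n → ℚ) →
    sumEdges adj Pg w
      ≡ sumWhere PN (vertWeight adj ℓ w) + sumEdges (quotAdj adj ℓ) PQ (edgeWeight adj ℓ w)
  sumEdges-quotient w = begin
    sumEdges adj Pg w
      ≡⟨ sumFin²≡sum² (λ x y → [ adj x y ∧ lt x y ∧ Pg x y ]· w x y) ⟩
    sum (λ x → sum (λ y → [ adj x y ∧ lt x y ∧ Pg x y ]· w x y))
      ≡⟨ sum-cong-≗ (λ x → sum-cong-≗ (edge-split w x)) ⟩
    sum (λ x → sum (λ y → sum (vertex-term x y) + sum (λ X → sum (edge-term x y X))))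
      ≡⟨ ∑-distrib-+² (λ x y → sum (vertex-term x y))
                      (λ x y → sum (λ X → sum (edge-term x y X))) ⟩
    sum (λ x → sum (λ y → sum (vertex-term x y)))
      + sum (λ x → sum (λ y → sum (λ X → sum (edge-term x y X))))
      ≡⟨ cong₂ _+_ vertex-reindex edge-reindex ⟨
    sumWhere PN (vertWeight adj ℓ w) + sumEdges (quotAdj adj ℓ) PQ (edgeWeight adj ℓ w) ∎
    where
    open ≡-Reasoning
    vertex-term : Fin n → Fin n → Fin m → ℚ
    vertex-term x y X = [ PN X ]· [ adj x y ∧ lt x y ∧ ((ℓ x == X) ∧ (ℓ y == X)) ]· w x y
    edge-term : Fin n → Fin n → Fin m → Fin m → ℚ
    edge-term x y X Y = [ counted X Y ]· [ adj x y ∧ lt x y ∧ links x y X Y ]· w x y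
    vertex-reindex : sumWhere PN (vertWeight adj ℓ w) ≡ sum (λ x → sum (λ y → sum (vertex-term x y)))
    vertex-reindex = trans (sumFin≡sum λ X → [ PN X ]· vertWeight adj ℓ w X)
      (trans (sum-cong-≗ λ X → []·-sumFin² (PN X) λ x y →
                [ adj x y ∧ lt x y ∧ ((ℓ x == X) ∧ (ℓ y == X)) ]· w x y)
             (∑-comm₁₂ λ X x y → vertex-term x y X))
    edge-reindex : sumEdges (quotAdj adj ℓ) PQ (edgeWeight adj ℓ w)
                   ≡ sum (λ x → sum (λ y → sum (λ X → sum (edge-term x y X))))
    edge-reindex = trans (sumFin²≡sum² λ X Y → [ counted X Y ]· edgeWeight adj ℓ w X Y)
      (trans (sum-cong-≗ λ X → sum-cong-≗ λ Y → []·-sumFin² (counted X Y) λ x y →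
                [ adj x y ∧ lt x y ∧ links x y X Y ]· w x y)
             (∑-comm₂₂ λ X Y x y → edge-term x y X Y))

module Sides {n k m : ℕ} (adj : Adjacency n) (simple : IsSimple adj)
  {d : Fin n → Fin n → ℕ} (isDist : IsDist adj d)
  (c : Fin n → Fin n → Fin k) (i : Fin k)
  (Θ-closed : ∀ (e f : Edge adj) → Θ d e f → c (src e) (tgt e) ≡ c (src f) (tgt f))
  {ℓ : Fin n → Fin m} (component : IsComponentMap adj c i ℓ)
  {dQ : Fin m → Fin m → ℕ} (isDistQ : IsDist (quotAdj adj ℓ) dQ)
  {u v : Fin n} (uv : Edge? adj u v) (F : c u v ≡ i) where

  open QuotientDistance adj simple isDist c i Θ-closed component isDistQ

  vertex-side : ∀ x → (d u x <ᵇ d v x) ≡ (dQ (ℓ u) (ℓ x) <ᵇ dQ (ℓ v) (ℓ x))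
  vertex-side x = <ᵇ-cong-diff (λ w → d w x) (λ w → dQ (ℓ w) (ℓ x)) (F-edge-gap uv F x)

  internal-edge-side : ∀ {x y} → Edge? adj x y → ℓ x ≡ ℓ y →
    (distE d u x y <ᵇ distE d v x y) ≡ (dQ (ℓ u) (ℓ x) <ᵇ dQ (ℓ v) (ℓ x))
  internal-edge-side {x} {y} xy same = trans
    (<ᵇ-cong-diff (λ w → distE d w x y) (λ w → d w x)
      (⊓-shift (d u) (d v) (ℕP.+-comm (d u x) (d v x))
                           (trans (sym balanced) (ℕP.+-comm (d u x) (d v y)))))
    (vertex-side x)
    where
    balanced : d u x ℕ.+ d v y ≡ d u y ℕ.+ d v x
    balanced = trans (not-Θ uv xy λ Fxy → F-edge-crossing xy (trans (sym Fxy) F) same)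
                     (cong (ℕ._+_ (d u y)) (d-sym x v))

  crossing-edge-side : ∀ {x y} → Edge? adj x y → ℓ x ≢ ℓ y →
    (distE d u x y <ᵇ distE d v x y)
      ≡ (distE dQ (ℓ u) (ℓ x) (ℓ y) <ᵇ distE dQ (ℓ v) (ℓ x) (ℓ y))
  crossing-edge-side {x} {y} xy differ =
    <ᵇ-shift (λ w → distE d w x y) (λ w → distE dQ (ℓ w) (ℓ x) (ℓ y))
      (⊓-shift (d u) (dQ (ℓ u) ∘ ℓ) ux uy)
      (⊓-shift (d v) (dQ (ℓ v) ∘ ℓ) (to-v x ux) (to-v y uy))
    where
    ux : d u x ℕ.+ dQ (ℓ u) (ℓ x) ≡ dQ (ℓ u) (ℓ x) ℕ.+ d u x
    ux = ℕP.+-comm (d u x) (dQ (ℓ u) (ℓ x))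
    uy : d u y ℕ.+ dQ (ℓ u) (ℓ x) ≡ dQ (ℓ u) (ℓ y) ℕ.+ d u x
    uy = trans (sym (trans (cong₂ ℕ._+_ (d-sym u x) (Q.d-sym (ℓ u) (ℓ y)))
                    (trans (F-edge-gap xy (crossing-F-edge xy differ) u)
                           (cong₂ ℕ._+_ (d-sym y u) (Q.d-sym (ℓ x) (ℓ u))))))
               (ℕP.+-comm (d u x) (dQ (ℓ u) (ℓ y)))
    to-v : ∀ z → d u z ℕ.+ dQ (ℓ u) (ℓ x) ≡ dQ (ℓ u) (ℓ z) ℕ.+ d u x →
                 d v z ℕ.+ dQ (ℓ u) (ℓ x) ≡ dQ (ℓ v) (ℓ z) ℕ.+ d u x
    to-v z = shift-trans (λ w → d w z) (λ w → dQ (ℓ w) (ℓ z)) (F-edge-gap uv F z)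

  mPart-decomposition : ∀ (w : Fin n → Fin n → ℚ) →
    mPart adj d w u v ≡ nPart dQ (vertWeight adj ℓ w) (ℓ u) (ℓ v)
                      + mPart (quotAdj adj ℓ) dQ (edgeWeight adj ℓ w) (ℓ u) (ℓ v)
  mPart-decomposition = sumEdges-quotient
    where
    open QuotientSum adj (proj₁ simple) ℓ
      (λ X → dQ (ℓ u) X <ᵇ dQ (ℓ v) X)
      (λ X Y → distE dQ (ℓ u) X Y <ᵇ distE dQ (ℓ v) X Y)
      (λ X Y → cong₂ _<ᵇ_ (ℕP.⊓-comm (dQ (ℓ u) X) (dQ (ℓ u) Y))
                          (ℕP.⊓-comm (dQ (ℓ v) X) (dQ (ℓ v) Y)))
      (λ x y → distE d u x y <ᵇ distE d v x y)
      internal-edge-side crossing-edge-side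

-- Unused hypotheses: connectivity (implied by IsDist), the sign and symmetry of λ' (both
-- sides weight each edge xy, x < y, by λ' x y), and adjacency of ℓ u and ℓ v in G/F (which
-- follows from F-edge-crossing).
lemma3p3 : ∀ {n k m : ℕ} (adj : Adjacency n) (dG : Fin n → Fin n → ℕ)
    (c : Fin n → Fin n → Fin k) (λ' : Fin n → Fin n → ℚ)
    (i : Fin k) (ℓ : Fin n → Fin m) (dQ : Fin m → Fin m → ℕ) (u v : Fin n) →
    IsSimple adj → Connected adj → IsDist adj dG →
    IsCPartition adj dG c →
    (∀ x y → adj x y ≡ true → 0ℚ ≤ λ' x y) →
    (∀ x y → adj x y ≡ true → λ' x y ≡ λ' y x) →
    IsComponentMap adj c i ℓ →
    IsDist (quotAdj adj ℓ) dQ →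
    adj u v ≡ true → c u v ≡ i →
    quotAdj adj ℓ (ℓ u) (ℓ v) ≡ true →
    (mPart adj dG λ' u v
       ≡ nPart dQ (vertWeight adj ℓ λ') (ℓ u) (ℓ v)
         + mPart (quotAdj adj ℓ) dQ (edgeWeight adj ℓ λ') (ℓ u) (ℓ v))
    × (mPart adj dG λ' v u
       ≡ nPart dQ (vertWeight adj ℓ λ') (ℓ v) (ℓ u)
         + mPart (quotAdj adj ℓ) dQ (edgeWeight adj ℓ λ') (ℓ v) (ℓ u))
lemma3p3 adj dG c λ' i ℓ dQ u v simple _ isDist (_ , Θ*-closed) _ _ component isDistQ uv F _ =
  Sides.mPart-decomposition adj simple isDist c i Θ-closed component isDistQ uv F λ' ,
  Sides.mPart-decomposition adj simple isDist c i Θ-closed component isDistQ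
    (adj-sym uv) (trans (c-sym uv) F) λ'
  where
  Θ-closed : ∀ (e f : Edge adj) → Θ dG e f → c (src e) (tgt e) ≡ c (src f) (tgt f)
  Θ-closed e f eΘf = Θ*-closed e f [ eΘf ]
  open ClassCount adj simple isDist c i Θ-closed using (adj-sym; c-sym)
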